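{- Let $p$ be a prime, $q$ a power of $p$, $m \in \mathbb{F}_q \setminus\{0\}$, and write $F(p,m) = (a_{i,j})$ and $F(p,m^{ -1}) = (a'_{i,j})$, $0 \le i,j\le p-1$. Then: (1) for all $0\le i,j\le p-1$, $a'_{i,p-1-j} = a_{i,j}(-m)^{ -i}$; (2) for all $0\le i,j\le p-1$, $a_{i,j}(-m)^{ -i} = a_{p-1-j,p-1-i}(-m)^{j+1-p}$; (3) $\delta F(p,m) = \delta\Sigma F(p,m^{ -1}) = \Sigma\delta F(p,m^{ -1})$; (4) the matrix $\delta F(p,m)$ is symmetric with respect to both diagonals, i.e. it is invariant under $(i,j)\mapsto(j,i)$ and under $(i,j)\mapsto(p-1-j,p-1-i)$, and so is every tensor power $(\delta F(p,m))^{\otimes d}$, $d\ge1$ (with the indices $p-1$ replaced by $p^d-1$); (5) for each $d\ge1$, $M_d$ contains a zero if and only if $M_1 = F(p,m)$ contains a zero; and if this is the case, then $[\mathbb{F}_p(m):\mathbb{F}_p] \le \frac{p-1}{2}$.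
   Context: For $m\in\mathbb{F}_q$ and $d\ge1$, $M_d = (a_{i,j})_{0\le i,j\le p^d-1}$ is the $p^d\times p^d$ matrix over $\mathbb{F}_q$ with $a_{i,0} = a_{0,j}=1$ and $a_{i,j} = a_{i-1,j} + m\,a_{i-1,j-1} + a_{i,j-1}$ for $i,j\ge1$, and $F(p,m) = M_1$. For a matrix $A$ over $\mathbb{F}_q$, $\delta(A)$ is the $\{0,1\}$-matrix obtained by replacing every nonzero entry by $1$. For a matrix $A = (\vec a_1,\dots,\vec a_n)$ given by columns, $\Sigma A = (\vec a_n,\dots,\vec a_1)$. Tensor product: $A\otimes B = (a_{i,j}B)$, $D^{\otimes1}=D$, $D^{\otimes(d+1)} = D^{\otimes d}\otimes D$. -}

module Defs where

open import Level using (Level; _⊔_) renaming (suc to lsuc)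
open import Data.Nat using (ℕ; zero; suc; _∸_; _<_; _^_; NonZero)
open import Data.Nat.DivMod using (_/_; _%_)
open import Data.Bool using (Bool; true; false; _∧_)
open import Data.Fin using (Fin)
open import Data.Product using (∃; ∃-syntax; _×_)
open import Algebra.Bundles using (CommutativeRing)
open import Relation.Nullary using (¬_; does)
open import Relation.Binary.Definitions using (Decidable)
open import Relation.Binary.PropositionalEquality as ≡ using (_≡_)
open import Function.Bundles using (Inverse)

record FiniteField (c ℓ : Level) : Set (lsuc (c ⊔ ℓ)) where
  field
    commRing : CommutativeRing c ℓ
  open CommutativeRing commRing public
  field
    _⁻¹      : Carrier → Carrier
    1≉0      : ¬ (1# ≈ 0#)
    ⁻¹-inverseʳ : ∀ x → ¬ (x ≈ 0#) → (x * (x ⁻¹)) ≈ 1#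
    _≟_      : Decidable _≈_
    size     : ℕ
    enumeration : Inverse (≡.setoid (Fin size)) setoid

module FieldDefs {c ℓ : Level} (K : FiniteField c ℓ) where
  open FiniteField K

  pow : Carrier → ℕ → Carrier
  pow x zero    = 1#
  pow x (suc n) = x * pow x n

  ι : ℕ → Carrier
  ι zero    = 0#
  ι (suc n) = 1# + ι n

  -- Entries a_{i,j} of the matrices M_d (for parameter m): M_d is the
  -- restriction of this array to 0 ≤ i,j ≤ p^d - 1, and F(p,m) = M_1.
  entry : Carrier → ℕ → ℕ → Carrier
  entry m zero    j       = 1#
  entry m (suc i) zero    = 1#
  entry m (suc i) (suc j) = (entry m i (suc j) + m * entry m i j) + entry m (suc i) j

  δ : (ℕ → ℕ → Carrier) → (ℕ → ℕ → Bool)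
  δ A i j = Data.Bool.not (does (A i j ≟ 0#))
    where import Data.Bool

  sumTo : ℕ → (ℕ → Carrier) → Carrier
  sumTo zero    f = 0#
  sumTo (suc n) f = sumTo n f + f n

  -- [F_p(m) : F_p] ≤ k, i.e. the minimal polynomial of m over the prime
  -- field F_p = {ι 0, …, ι (p-1)} has degree ≤ k: there is a nonzero
  -- polynomial Σ_{i ≤ k} c_i X^i with c_i ∈ F_p having m as a root.
  ExtDegree≤ : (p : ℕ) → Carrier → ℕ → Set ℓ
  ExtDegree≤ p m k =
    ∃ λ (cf : ℕ → ℕ) → ((∀ i → cf i < p)
           × (∃ λ (i : ℕ) → (i Data.Nat.≤ k × ¬ (ι (cf i) ≈ 0#)))
           × (sumTo (suc k) (λ i → ι (cf i) * pow m i) ≈ 0#))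
    where import Data.Nat

Σrev : {a : Level} {A : Set a} → ℕ → (ℕ → ℕ → A) → (ℕ → ℕ → A)
Σrev n A i j = A i (n ∸ 1 ∸ j)

_⊗[_]_ : (ℕ → ℕ → Bool) → (n : ℕ) → .{{NonZero n}} → (ℕ → ℕ → Bool) → (ℕ → ℕ → Bool)
(A ⊗[ n ] B) i j = A (i / n) (j / n) ∧ B (i % n) (j % n)

-- tensor powers D^{⊗d} of a p×p {0,1}-matrix D (d ≥ 1; d = 0 unused)
tpow : (p : ℕ) → .{{NonZero p}} → (ℕ → ℕ → Bool) → ℕ → (ℕ → ℕ → Bool)
tpow p D zero          = λ _ _ → true
tpow p D (suc zero)    = D
tpow p D (suc (suc d)) = tpow p D (suc d) ⊗[ p ] D

BothDiagSymmetric : {a : Level} {A : Set a} → ℕ → (ℕ → ℕ → A) → Set a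
BothDiagSymmetric N T =
  ∀ i j → i < N → j < N → (T i j ≡ T j i) × (T i j ≡ T (N ∸ 1 ∸ j) (N ∸ 1 ∸ i))

{-# OPTIONS --safe #-}
module Submission where

-- Over any field, a_{i,j} = Σ_k C(i,k) C(j,k) (1 + m)^k (Delannoy), and in characteristic p
-- C(p - 1, k) = (-1)^k, so the last column of F(p,m) is a_{i,p-1} = (-m)^i.  Since both a and the
-- column-reversed, row-rescaled a′ satisfy the same recurrence with the same boundary values, this gives (1);
-- together with a_{i,j} = a_{j,i} it gives (2), and (3), (4) follow because the factors (-m)^{-i} are nonzero.
-- Kronecker products preserve both-diagonal symmetry because the base-p digits of p^d - 1 - j are the
-- complements of those of j.  For (5), the same last column yields a Lucas-type factorisation
-- a_{r+ip, s+jp}(m) = a_{i,j}(m^p) a_{r,s}(m), and a_{i,j}(m^p) = a_{i,j}(m)^p by Frobenius, so every zero of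
-- M_d comes from a zero of M_1.  Finally a_{x,y} is a polynomial in m over F_p of degree x with leading
-- coefficient C(y,x) ≢ 0 (mod p) for x ≤ y < p, and by (2) a zero can be moved to a position with x ≤ (p-1)/2.

open import Defs
open import Level using (Level)
open import Data.Nat using (ℕ; _∸_; _<_; _≤_; _^_; _/_)
open import Data.Nat.Primality using (Prime; prime⇒nonZero)
open import Data.Product using (_×_; ∃; ∃-syntax)
open import Relation.Nullary using (¬_)
open import Relation.Binary.PropositionalEquality using (_≡_)
open import Function.Bundles using (_⇔_)
open import Data.Nat using (zero; suc; NonZero)
open import Data.Product using (_,_)
open import Data.Empty using (⊥-elim)
import Relation.Binary.PropositionalEquality as ≡

module Arithmetic where

  open import Data.Nat using (_+_; _*_; _!; _%_)
  open import Data.Nat.Properties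
  open import Data.Nat.Combinatorics using (_C_; nCk≡n!/k![n-k]!; k![n∸k]!∣n!)
  open import Data.Nat.DivMod using (m/n*n≡m; m≡m%n+[m/n]*n; m%n<n)
  open import Relation.Binary.PropositionalEquality using (trans; cong)

  nCk*[k!*[n∸k]!]≡n! : ∀ {n k} → k ≤ n → (n C k) * (k ! * (n ∸ k) !) ≡ n !
  nCk*[k!*[n∸k]!]≡n! {n} {k} k≤n =
    trans (cong (_* (k ! * (n ∸ k) !)) (nCk≡n!/k![n-k]! k≤n)) (m/n*n≡m (k![n∸k]!∣n! k≤n))
    where instance _ = k !* (n ∸ k) !≢0

  n≤1+2[n/2] : ∀ n → n ≤ suc (n / 2) + n / 2
  n≤1+2[n/2] n = begin
    n                          ≡⟨ m≡m%n+[m/n]*n n 2 ⟩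
    n % 2 + (n / 2) * 2        ≤⟨ +-mono-≤ (≤-pred (m%n<n n 2)) (≤-reflexive (*-comm (n / 2) 2)) ⟩
    1 + 2 * (n / 2)            ≡⟨ cong (λ t → suc (n / 2 + t)) (+-identityʳ (n / 2)) ⟩
    suc (n / 2) + n / 2        ∎
    where open ≤-Reasoning

module EntryCoefficients where

  open import Data.Nat using (_+_; s≤s)
  open import Data.Nat.Properties using (n<1+n; m<n⇒m<1+n)
  open import Data.Nat.Combinatorics using (_C_; nCk+nC[k+1]≡[n+1]C[k+1])
  open import Relation.Binary.PropositionalEquality using (refl)

  -- The coefficient of m^k in a_{i,j}, read off from the defining recurrence.
  entryCoeff : ℕ → ℕ → ℕ → ℕ
  entryCoeff zero    j       zero    = 1
  entryCoeff zero    j       (suc k) = 0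
  entryCoeff (suc i) zero    zero    = 1
  entryCoeff (suc i) zero    (suc k) = 0
  entryCoeff (suc i) (suc j) zero    = entryCoeff i (suc j) zero + entryCoeff (suc i) j zero
  entryCoeff (suc i) (suc j) (suc k) =
    (entryCoeff i (suc j) (suc k) + entryCoeff i j k) + entryCoeff (suc i) j (suc k)

  entryCoeff-vanish : ∀ i j k → i < k → entryCoeff i j k ≡ 0
  entryCoeff-vanish zero    j       (suc k) _ = refl
  entryCoeff-vanish (suc i) zero    (suc k) _ = refl
  entryCoeff-vanish (suc i) (suc j) (suc k) (s≤s i<k)
    rewrite entryCoeff-vanish i (suc j) (suc k) (m<n⇒m<1+n i<k)
          | entryCoeff-vanish i j k i<k
          | entryCoeff-vanish (suc i) j (suc k) (s≤s i<k) = refl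

  entryCoeff-leading : ∀ i j → entryCoeff i j i ≡ j C i
  entryCoeff-leading zero    j       = refl
  entryCoeff-leading (suc i) zero    = refl
  entryCoeff-leading (suc i) (suc j)
    rewrite entryCoeff-vanish i (suc j) (suc i) (n<1+n i)
          | entryCoeff-leading i j
          | entryCoeff-leading (suc i) j = nCk+nC[k+1]≡[n+1]C[k+1] j i

module TensorSymmetry (n : ℕ) where

  open import Data.Nat using (_+_; _*_; _%_; z≤n; s≤s)
  open import Data.Nat.Properties
  open import Data.Nat.DivMod
  open import Data.Nat.Tactic.RingSolver using (solve-∀)
  open import Data.Bool using (Bool; _∧_)
  open import Relation.Nullary using (contradiction)
  open import Relation.Binary.PropositionalEquality using (refl; cong; cong₂; sym; trans; subst)
  open Relation.Binary.PropositionalEquality.≡-Reasoning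

  private
    p : ℕ
    p = suc n

  [m+kp]/p≡k : ∀ {m} k → m < p → (m + k * p) / p ≡ k
  [m+kp]/p≡k {m} k m<p = begin
    (m + k * p) / p     ≡⟨ +-distrib-/ m (k * p) m%p+kp%p<p ⟩
    m / p + k * p / p   ≡⟨ cong₂ _+_ (m<n⇒m/n≡0 m<p) (m*n/n≡m k p) ⟩
    k                   ∎
    where
    m%p+kp%p<p : m % p + (k * p) % p < p
    m%p+kp%p<p = subst (_< p)
      (sym (trans (cong₂ _+_ (m<n⇒m%n≡m m<p) (m*n%n≡0 k p)) (+-identityʳ m))) m<p

  [m+kp]%p≡m : ∀ {m} k → m < p → (m + k * p) % p ≡ m
  [m+kp]%p≡m {m} k m<p = trans ([m+kn]%n≡m%n m k p) (m<n⇒m%n≡m m<p)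

  m<pN⇒m/p<N : ∀ {m} N → m < p * N → m / p < N
  m<pN⇒m/p<N {m} N m<pN = m<n*o⇒m/o<n (subst (m <_) (*-comm p N) m<pN)

  private
    complement-sum : ∀ {a b r q} → r ≤ a → q ≤ b →
      (a ∸ r) + (b ∸ q) * suc a + suc (r + q * suc a) ≡ suc a * suc b
    complement-sum {a} {b} {r} {q} r≤a q≤b
      with a ∸ r | m∸n+n≡m r≤a | b ∸ q | m∸n+n≡m q≤b
    ... | x | refl | y | refl = identity x y r q
      where
      identity : ∀ x y r q → x + y * suc (x + r) + suc (r + q * suc (x + r)) ≡ suc (x + r) * suc (y + q)
      identity = solve-∀

  reflect-digits : ∀ N j → j < p * N → p * N ∸ 1 ∸ j ≡ (n ∸ j % p) + (N ∸ 1 ∸ j / p) * p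
  reflect-digits zero j j<p*0 = contradiction (subst (j <_) (*-zeroʳ p) j<p*0) n≮0
  reflect-digits (suc M) j j<pN = begin
    p * suc M ∸ 1 ∸ j         ≡⟨ ∸-+-assoc (p * suc M) 1 j ⟩
    p * suc M ∸ suc j         ≡⟨ cong (λ t → p * suc M ∸ suc t) (m≡m%n+[m/n]*n j p) ⟩
    p * suc M ∸ suc (r + q * p) ≡⟨ cong (_∸ suc (r + q * p)) (sym (complement-sum r≤n q≤M)) ⟩
    X + suc (r + q * p) ∸ suc (r + q * p) ≡⟨ m+n∸n≡m X (suc (r + q * p)) ⟩
    X                         ∎
    where
    r q X : ℕ
    r = j % p
    q = j / p
    X = (n ∸ r) + (M ∸ q) * p
    r≤n : r ≤ n
    r≤n = ≤-pred (m%n<n j p)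
    q≤M : q ≤ M
    q≤M = ≤-pred (m<pN⇒m/p<N (suc M) j<pN)

  reflect-/ : ∀ N j → j < p * N → (p * N ∸ 1 ∸ j) / p ≡ N ∸ 1 ∸ j / p
  reflect-/ N j j<pN =
    trans (cong (_/ p) (reflect-digits N j j<pN)) ([m+kp]/p≡k (N ∸ 1 ∸ j / p) (s≤s (m∸n≤m n (j % p))))

  reflect-% : ∀ N j → j < p * N → (p * N ∸ 1 ∸ j) % p ≡ n ∸ j % p
  reflect-% N j j<pN =
    trans (cong (_% p) (reflect-digits N j j<pN)) ([m+kp]%p≡m (N ∸ 1 ∸ j / p) (s≤s (m∸n≤m n (j % p))))

  ⊗-bothDiagSymmetric : ∀ N (T D : ℕ → ℕ → Bool) →
    BothDiagSymmetric N T → BothDiagSymmetric p D → BothDiagSymmetric (p * N) (T ⊗[ p ] D)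
  ⊗-bothDiagSymmetric N T D symT symD i j i<pN j<pN
    with symT (i / p) (j / p) (m<pN⇒m/p<N N i<pN) (m<pN⇒m/p<N N j<pN) | symD (i % p) (j % p) (m%n<n i p) (m%n<n j p)
  ... | T-diag , T-antidiag | D-diag , D-antidiag =
    cong₂ _∧_ T-diag D-diag ,
    trans (cong₂ _∧_ T-antidiag D-antidiag)
          (sym (cong₂ _∧_ (cong₂ T (reflect-/ N j j<pN) (reflect-/ N i i<pN))
                          (cong₂ D (reflect-% N j j<pN) (reflect-% N i i<pN))))

  tpow-bothDiagSymmetric : ∀ D → BothDiagSymmetric p D →
    ∀ d → 1 ≤ d → BothDiagSymmetric (p ^ d) (tpow p D d)
  tpow-bothDiagSymmetric D symD (suc zero) _ =
    subst (λ N → BothDiagSymmetric N D) (sym (*-identityʳ p)) symD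
  tpow-bothDiagSymmetric D symD (suc (suc d)) _ =
    ⊗-bothDiagSymmetric (p ^ suc d) (tpow p D (suc d)) D
      (tpow-bothDiagSymmetric D symD (suc d) (s≤s z≤n)) symD

module FieldProperties {a ℓ : Level} (K : FiniteField a ℓ) where

  open FiniteField K
  open FieldDefs K
  open import Data.Nat using (z≤n; s≤s)
  import Data.Nat as ℕ
  import Data.Nat.Properties as ℕ
  open import Data.Nat.Combinatorics using (_C_; nCk+nC[k+1]≡[n+1]C[k+1])
  open EntryCoefficients
  open import Data.Sum using (_⊎_; inj₁; inj₂)
  open import Relation.Nullary using (yes; no; does; contradiction)
  open import Algebra.Properties.Group +-group using (∙-cancelˡ; ∙-cancelʳ; inverseʳ-unique; ⁻¹-involutive)
  open import Algebra.Properties.Ring ring using (-1*x≈-x; -‿distribˡ-*; -‿distribʳ-*)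
  open import Function.Bundles using (Inverse)
  open import Algebra.Solver.Ring.NaturalCoefficients.Default commutativeSemiring
  open import Relation.Binary.Reasoning.Setoid setoid

  ⁻¹-inverseˡ : ∀ {x} → x ≉ 0# → x ⁻¹ * x ≈ 1#
  ⁻¹-inverseˡ {x} x≉0 = trans (*-comm (x ⁻¹) x) (⁻¹-inverseʳ x x≉0)

  *-≉0 : ∀ {x y} → x ≉ 0# → y ≉ 0# → x * y ≉ 0#
  *-≉0 {x} {y} x≉0 y≉0 xy≈0 = y≉0 (begin
    y                ≈⟨ *-identityˡ y ⟨
    1# * y           ≈⟨ *-congʳ (⁻¹-inverseˡ x≉0) ⟨
    (x ⁻¹ * x) * y   ≈⟨ *-assoc (x ⁻¹) x y ⟩
    x ⁻¹ * (x * y)   ≈⟨ *-congˡ xy≈0 ⟩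
    x ⁻¹ * 0#        ≈⟨ zeroʳ (x ⁻¹) ⟩
    0#               ∎)

  x*y≈0⇒x≈0⊎y≈0 : ∀ {x y} → x * y ≈ 0# → x ≈ 0# ⊎ y ≈ 0#
  x*y≈0⇒x≈0⊎y≈0 {x} {y} xy≈0 with x ≟ 0# | y ≟ 0#
  ... | yes x≈0 | _       = inj₁ x≈0
  ... | no _    | yes y≈0 = inj₂ y≈0
  ... | no x≉0  | no y≉0  = contradiction xy≈0 (*-≉0 x≉0 y≉0)

  x*y≈0⇒x≈0 : ∀ {x y} → y ≉ 0# → x * y ≈ 0# → x ≈ 0#
  x*y≈0⇒x≈0 {x} y≉0 xy≈0 with x ≟ 0#
  ... | yes x≈0 = x≈0
  ... | no x≉0  = contradiction xy≈0 (*-≉0 x≉0 y≉0)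

  x≈0⇒x*y≈0 : ∀ {x} y → x ≈ 0# → x * y ≈ 0#
  x≈0⇒x*y≈0 y x≈0 = trans (*-congʳ x≈0) (zeroˡ y)

  -x*-y≈x*y : ∀ x y → - x * - y ≈ x * y
  -x*-y≈x*y x y = begin
    - x * - y        ≈⟨ -‿distribˡ-* x (- y) ⟨
    - (x * - y)      ≈⟨ -‿cong (-‿distribʳ-* x y) ⟨
    - - (x * y)      ≈⟨ ⁻¹-involutive (x * y) ⟩
    x * y            ∎

  ⁻¹-≉0 : ∀ {x} → x ≉ 0# → x ⁻¹ ≉ 0#
  ⁻¹-≉0 {x} x≉0 x⁻¹≈0 = 1≉0 (begin
    1#         ≈⟨ ⁻¹-inverseʳ x x≉0 ⟨
    x * x ⁻¹   ≈⟨ *-congˡ x⁻¹≈0 ⟩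
    x * 0#     ≈⟨ zeroʳ x ⟩
    0#         ∎)

  -‿≉0 : ∀ {x} → x ≉ 0# → - x ≉ 0#
  -‿≉0 {x} x≉0 -x≈0 = x≉0 (begin
    x            ≈⟨ +-identityʳ x ⟨
    x + 0#       ≈⟨ +-congˡ -x≈0 ⟨
    x + - x      ≈⟨ -‿inverseʳ x ⟩
    0#           ∎)

  does-≈0-≡ : ∀ {x y} → (x ≈ 0# → y ≈ 0#) → (y ≈ 0# → x ≈ 0#) → does (x ≟ 0#) ≡ does (y ≟ 0#)
  does-≈0-≡ {x} {y} x⇒y y⇒x with x ≟ 0# | y ≟ 0#
  ... | yes _   | yes _   = ≡.refl
  ... | no _    | no _    = ≡.refl
  ... | yes x≈0 | no y≉0  = contradiction (x⇒y x≈0) y≉0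
  ... | no x≉0  | yes y≈0 = contradiction (y⇒x y≈0) x≉0

  does-≈0-balance : ∀ {x y u v} → u ≉ 0# → v ≉ 0# → x * u ≈ y * v → does (x ≟ 0#) ≡ does (y ≟ 0#)
  does-≈0-balance {u = u} {v} u≉0 v≉0 xu≈yv = does-≈0-≡
    (λ x≈0 → x*y≈0⇒x≈0 v≉0 (trans (sym xu≈yv) (x≈0⇒x*y≈0 u x≈0)))
    (λ y≈0 → x*y≈0⇒x≈0 u≉0 (trans xu≈yv (x≈0⇒x*y≈0 v y≈0)))

  pow-cong : ∀ {x y} n → x ≈ y → pow x n ≈ pow y n
  pow-cong zero    x≈y = refl
  pow-cong (suc n) x≈y = *-cong x≈y (pow-cong n x≈y)

  pow-distribʳ-* : ∀ x y n → pow (x * y) n ≈ pow x n * pow y n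
  pow-distribʳ-* x y zero    = sym (*-identityˡ 1#)
  pow-distribʳ-* x y (suc n) = trans (*-congˡ (pow-distribʳ-* x y n))
    (solve 4 (λ x y a b → (x :* y) :* (a :* b) := (x :* a) :* (y :* b)) refl x y (pow x n) (pow y n))

  pow-1# : ∀ n → pow 1# n ≈ 1#
  pow-1# zero    = refl
  pow-1# (suc n) = trans (*-identityˡ (pow 1# n)) (pow-1# n)

  pow-≉0 : ∀ {x} n → x ≉ 0# → pow x n ≉ 0#
  pow-≉0 zero    x≉0 = 1≉0
  pow-≉0 (suc n) x≉0 = *-≉0 x≉0 (pow-≉0 n x≉0)

  pow≈0⇒≈0 : ∀ {x} n → pow x n ≈ 0# → x ≈ 0#
  pow≈0⇒≈0 {x} n xⁿ≈0 with x ≟ 0#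
  ... | yes x≈0 = x≈0
  ... | no x≉0  = contradiction xⁿ≈0 (pow-≉0 n x≉0)

  pow-inverse : ∀ {x} n → x ≉ 0# → pow x n * pow (x ⁻¹) n ≈ 1#
  pow-inverse {x} n x≉0 = begin
    pow x n * pow (x ⁻¹) n   ≈⟨ pow-distribʳ-* x (x ⁻¹) n ⟨
    pow (x * x ⁻¹) n         ≈⟨ pow-cong n (⁻¹-inverseʳ x x≉0) ⟩
    pow 1# n                 ≈⟨ pow-1# n ⟩
    1#                       ∎

  ι-homo-+ : ∀ a b → ι (a ℕ.+ b) ≈ ι a + ι b
  ι-homo-+ zero    b = sym (+-identityˡ (ι b))
  ι-homo-+ (suc a) b = trans (+-congˡ (ι-homo-+ a b)) (sym (+-assoc 1# (ι a) (ι b)))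

  ι-homo-* : ∀ a b → ι (a ℕ.* b) ≈ ι a * ι b
  ι-homo-* zero    b = sym (zeroˡ (ι b))
  ι-homo-* (suc a) b = begin
    ι (b ℕ.+ a ℕ.* b)    ≈⟨ ι-homo-+ b (a ℕ.* b) ⟩
    ι b + ι (a ℕ.* b)    ≈⟨ +-congˡ (ι-homo-* a b) ⟩
    ι b + ι a * ι b      ≈⟨ solve 2 (λ x y → y :+ x :* y := (con 1 :+ x) :* y) refl (ι a) (ι b) ⟩
    (1# + ι a) * ι b     ∎

  ι-1 : ι 1 ≈ 1#
  ι-1 = +-identityʳ 1#

  ι-homo-^ : ∀ a b → ι (a ℕ.^ b) ≈ pow (ι a) b
  ι-homo-^ a zero    = ι-1
  ι-homo-^ a (suc b) = trans (ι-homo-* a (a ℕ.^ b)) (*-congˡ (ι-homo-^ a b))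

  sumTo-cong : ∀ N {f g} → (∀ k → k < N → f k ≈ g k) → sumTo N f ≈ sumTo N g
  sumTo-cong zero    f≈g = refl
  sumTo-cong (suc N) f≈g =
    +-cong (sumTo-cong N (λ k k<N → f≈g k (ℕ.m<n⇒m<1+n k<N))) (f≈g N (ℕ.n<1+n N))

  sumTo-zero : ∀ N f → (∀ k → k < N → f k ≈ 0#) → sumTo N f ≈ 0#
  sumTo-zero N f f≈0 = trans (sumTo-cong N f≈0) (sumTo-0# N)
    where
    sumTo-0# : ∀ N → sumTo N (λ _ → 0#) ≈ 0#
    sumTo-0# zero    = refl
    sumTo-0# (suc N) = trans (+-identityʳ _) (sumTo-0# N)

  sumTo-distrib-+ : ∀ N f g → sumTo N (λ k → f k + g k) ≈ sumTo N f + sumTo N g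
  sumTo-distrib-+ zero    f g = sym (+-identityˡ 0#)
  sumTo-distrib-+ (suc N) f g = trans (+-congʳ (sumTo-distrib-+ N f g))
    (solve 4 (λ a b c d → (a :+ b) :+ (c :+ d) := (a :+ c) :+ (b :+ d)) refl
      (sumTo N f) (sumTo N g) (f N) (g N))

  sumTo-distribˡ-* : ∀ N x f → sumTo N (λ k → x * f k) ≈ x * sumTo N f
  sumTo-distribˡ-* zero    x f = sym (zeroʳ x)
  sumTo-distribˡ-* (suc N) x f =
    trans (+-congʳ (sumTo-distribˡ-* N x f)) (sym (distribˡ x (sumTo N f) (f N)))

  sumTo-head : ∀ N f → sumTo (suc N) f ≈ f 0 + sumTo N (λ k → f (suc k))
  sumTo-head zero    f = trans (+-identityˡ (f 0)) (sym (+-identityʳ (f 0)))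
  sumTo-head (suc N) f =
    trans (+-congʳ (sumTo-head N f)) (+-assoc (f 0) (sumTo N (λ k → f (suc k))) (f (suc N)))

  sumTo-border : ∀ N T → T 0 ≈ 1# → (∀ k → T (suc k) ≈ 0#) → sumTo (suc N) T ≈ 1#
  sumTo-border N T T₀≈1 Tₛ≈0 =
    trans (sumTo-head N T) (trans (+-cong T₀≈1 (sumTo-zero N _ (λ k _ → Tₛ≈0 k))) (+-identityʳ 1#))

  entry-zeroʳ : ∀ m i → entry m i 0 ≈ 1#
  entry-zeroʳ m zero    = refl
  entry-zeroʳ m (suc i) = refl

  entry-comm : ∀ m i j → entry m i j ≈ entry m j i
  entry-comm m zero    zero    = refl
  entry-comm m zero    (suc j) = refl
  entry-comm m (suc i) zero    = refl
  entry-comm m (suc i) (suc j) = trans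
    (solve 3 (λ a b d → (a :+ b) :+ d := (d :+ b) :+ a) refl
      (entry m i (suc j)) (m * entry m i j) (entry m (suc i) j))
    (+-cong (+-cong (entry-comm m (suc i) j) (*-congˡ (entry-comm m i j))) (entry-comm m i (suc j)))

  ι-pascal : ∀ n k → ι (suc n C suc k) ≈ ι (n C k) + ι (n C suc k)
  ι-pascal n k = trans (reflexive (≡.cong ι (≡.sym (nCk+nC[k+1]≡[n+1]C[k+1] n k))))
                       (ι-homo-+ (n C k) (n C suc k))

  binomial : ∀ x i N → i < N → pow (1# + x) i ≈ sumTo N (λ k → ι (i C k) * pow x k)
  binomial x zero (suc N) _ = sym (begin
    sumTo (suc N) t                     ≈⟨ sumTo-head N t ⟩
    t 0 + sumTo N (λ k → t (suc k))     ≈⟨ +-cong (trans (*-identityʳ (ι 1)) ι-1)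
                                                  (sumTo-zero N _ (λ k _ → zeroˡ _)) ⟩
    1# + 0#                             ≈⟨ +-identityʳ 1# ⟩
    1#                                  ∎)
    where
    t : ℕ → Carrier
    t k = ι (0 C k) * pow x k
  binomial x (suc i) (suc N) (s≤s i<N) = begin
    (1# + x) * P
      ≈⟨ solve 2 (λ x P → (con 1 :+ x) :* P := P :+ x :* P) refl x P ⟩
    P + x * P
      ≈⟨ +-cong (binomial x i (suc N) (ℕ.m<n⇒m<1+n i<N)) (*-congˡ (binomial x i N i<N)) ⟩
    sumTo (suc N) g + x * sumTo N g
      ≈⟨ +-cong (sumTo-head N g) (sym (sumTo-distribˡ-* N x g)) ⟩
    (g 0 + sumTo N (λ k → g (suc k))) + sumTo N (λ k → x * g k)
      ≈⟨ +-assoc (g 0) _ _ ⟩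
    g 0 + (sumTo N (λ k → g (suc k)) + sumTo N (λ k → x * g k))
      ≈⟨ +-congˡ (sumTo-distrib-+ N _ _) ⟨
    g 0 + sumTo N (λ k → g (suc k) + x * g k)
      ≈⟨ +-congˡ (sumTo-cong N (λ k _ → pascal-term k)) ⟨
    h 0 + sumTo N (λ k → h (suc k))
      ≈⟨ sumTo-head N h ⟨
    sumTo (suc N) h ∎
    where
    P : Carrier
    P = pow (1# + x) i
    g h : ℕ → Carrier
    g k = ι (i C k) * pow x k
    h k = ι (suc i C k) * pow x k
    pascal-term : ∀ k → h (suc k) ≈ g (suc k) + x * g k
    pascal-term k = trans (*-congʳ (ι-pascal i k))
      (solve 4 (λ a b x q → (a :+ b) :* (x :* q) := b :* (x :* q) :+ x :* (a :* q)) refl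
        (ι (i C k)) (ι (i C suc k)) x (pow x k))

  delannoyTerm : Carrier → ℕ → ℕ → ℕ → Carrier
  delannoyTerm u i j k = ι (i C k) * ι (j C k) * pow u k

  delannoyTerm-pascal : ∀ u i j k →
    delannoyTerm u (suc i) (suc j) (suc k) + delannoyTerm u i j (suc k)
      ≈ (delannoyTerm u i (suc j) (suc k) + u * delannoyTerm u i j k) + delannoyTerm u (suc i) j (suc k)
  delannoyTerm-pascal u i j k = begin
    ι (suc i C suc k) * ι (suc j C suc k) * (u * U) + a₁ * b₁ * (u * U)
      ≈⟨ +-congʳ (*-congʳ (*-cong (ι-pascal i k) (ι-pascal j k))) ⟩
    (a₀ + a₁) * (b₀ + b₁) * (u * U) + a₁ * b₁ * (u * U)
      ≈⟨ solve 6 (λ a₀ a₁ b₀ b₁ u U → (a₀ :+ a₁) :* (b₀ :+ b₁) :* (u :* U) :+ a₁ :* b₁ :* (u :* U)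
                   := (a₁ :* (b₀ :+ b₁) :* (u :* U) :+ u :* (a₀ :* b₀ :* U)) :+ (a₀ :+ a₁) :* b₁ :* (u :* U))
           refl a₀ a₁ b₀ b₁ u U ⟩
    (a₁ * (b₀ + b₁) * (u * U) + u * (a₀ * b₀ * U)) + (a₀ + a₁) * b₁ * (u * U)
      ≈⟨ +-cong (+-congʳ (*-congʳ (*-congˡ (ι-pascal j k)))) (*-congʳ (*-congʳ (ι-pascal i k))) ⟨
    (a₁ * ι (suc j C suc k) * (u * U) + u * (a₀ * b₀ * U)) + ι (suc i C suc k) * b₁ * (u * U) ∎
    where
    a₀ a₁ b₀ b₁ U : Carrier
    a₀ = ι (i C k)
    a₁ = ι (i C suc k)
    b₀ = ι (j C k)
    b₁ = ι (j C suc k)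
    U = pow u k

  sumTo-pascal : ∀ N w (X T₀₀ T₀₁ T₁₀ : ℕ → Carrier) →
    X 0 ≈ T₀₁ 0 + T₁₀ 0 → (∀ k → X (suc k) ≈ (T₀₁ (suc k) + w * T₀₀ k) + T₁₀ (suc k)) →
    sumTo (suc N) X ≈ (sumTo (suc N) T₀₁ + w * sumTo N T₀₀) + sumTo (suc N) T₁₀
  sumTo-pascal N w X T₀₀ T₀₁ T₁₀ X₀ Xₛ = begin
    sumTo (suc N) X
      ≈⟨ sumTo-head N X ⟩
    X 0 + sumTo N (λ k → X (suc k))
      ≈⟨ +-cong X₀ (sumTo-cong N (λ k _ → Xₛ k)) ⟩
    (T₀₁ 0 + T₁₀ 0) + sumTo N (λ k → (T₀₁ (suc k) + w * T₀₀ k) + T₁₀ (suc k))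
      ≈⟨ +-congˡ (trans (sumTo-distrib-+ N _ _)
                        (+-congʳ (trans (sumTo-distrib-+ N _ _) (+-congˡ (sumTo-distribˡ-* N w T₀₀))))) ⟩
    (T₀₁ 0 + T₁₀ 0) + ((tail T₀₁ + w * sumTo N T₀₀) + tail T₁₀)
      ≈⟨ solve 5 (λ a b c d e → (a :+ b) :+ ((c :+ d) :+ e) := ((a :+ c) :+ d) :+ (b :+ e)) refl
           (T₀₁ 0) (T₁₀ 0) (tail T₀₁) (w * sumTo N T₀₀) (tail T₁₀) ⟩
    ((T₀₁ 0 + tail T₀₁) + w * sumTo N T₀₀) + (T₁₀ 0 + tail T₁₀)
      ≈⟨ +-cong (+-congʳ (sumTo-head N T₀₁)) (sumTo-head N T₁₀) ⟨
    (sumTo (suc N) T₀₁ + w * sumTo N T₀₀) + sumTo (suc N) T₁₀ ∎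
    where
    tail : (ℕ → Carrier) → Carrier
    tail T = sumTo N (λ k → T (suc k))

  delannoyTerm-zero : ∀ u i j → delannoyTerm u i j 0 ≈ 1#
  delannoyTerm-zero u i j = trans (*-identityʳ _) (trans (*-cong ι-1 ι-1) (*-identityˡ 1#))

  entry-delannoy : ∀ m i j N → i < N → entry m i j ≈ sumTo N (delannoyTerm (1# + m) i j)
  entry-delannoy m zero    j       (suc N) _ =
    sym (sumTo-border N _ (delannoyTerm-zero (1# + m) 0 j) (λ k → x≈0⇒x*y≈0 _ (zeroˡ _)))
  entry-delannoy m (suc i) zero    (suc N) _ =
    sym (sumTo-border N _ (delannoyTerm-zero (1# + m) (suc i) 0) (λ k → x≈0⇒x*y≈0 _ (zeroʳ _)))
  entry-delannoy m (suc i) (suc j) (suc N) (s≤s i<N) = ∙-cancelʳ D₀₀ _ _ (begin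
    (entry m i (suc j) + m * entry m i j) + entry m (suc i) j + D₀₀
      ≈⟨ +-congʳ (+-cong (+-cong (entry-delannoy m i (suc j) (suc N) i<1+N)
                                 (*-congˡ (entry-delannoy m i j N i<N)))
                         (entry-delannoy m (suc i) j (suc N) (s≤s i<N))) ⟩
    (D₀₁ + m * D₀₀) + D₁₀ + D₀₀
      ≈⟨ solve 4 (λ a b c m → (a :+ m :* b) :+ c :+ b := (a :+ (con 1 :+ m) :* b) :+ c) refl D₀₁ D₀₀ D₁₀ m ⟩
    (D₀₁ + (1# + m) * D₀₀) + D₁₀
      ≈⟨ sumTo-pascal N (1# + m) _ _ _ _ refl (delannoyTerm-pascal (1# + m) i j) ⟨
    sumTo (suc N) (λ k → delannoyTerm (1# + m) (suc i) (suc j) k + delannoyTerm (1# + m) i j k)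
      ≈⟨ sumTo-distrib-+ (suc N) _ _ ⟩
    D₁₁ + sumTo (suc N) (delannoyTerm (1# + m) i j)
      ≈⟨ +-congˡ (trans (sym (entry-delannoy m i j (suc N) i<1+N)) (entry-delannoy m i j N i<N)) ⟩
    D₁₁ + D₀₀ ∎)
    where
    i<1+N : i < suc N
    i<1+N = ℕ.m<n⇒m<1+n i<N
    D₀₁ D₀₀ D₁₀ D₁₁ : Carrier
    D₀₁ = sumTo (suc N) (delannoyTerm (1# + m) i (suc j))
    D₀₀ = sumTo N (delannoyTerm (1# + m) i j)
    D₁₀ = sumTo (suc N) (delannoyTerm (1# + m) (suc i) j)
    D₁₁ = sumTo (suc N) (delannoyTerm (1# + m) (suc i) (suc j))

  polynomialTerm : Carrier → ℕ → ℕ → ℕ → Carrier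
  polynomialTerm m i j k = ι (entryCoeff i j k) * pow m k

  entry-polynomial : ∀ m i j N → i < N → entry m i j ≈ sumTo N (polynomialTerm m i j)
  entry-polynomial m zero    j       (suc N) _ =
    sym (sumTo-border N _ (trans (*-identityʳ (ι 1)) ι-1) (λ k → zeroˡ _))
  entry-polynomial m (suc i) zero    (suc N) _ =
    sym (sumTo-border N _ (trans (*-identityʳ (ι 1)) ι-1) (λ k → zeroˡ _))
  entry-polynomial m (suc i) (suc j) (suc N) (s≤s i<N) = begin
    (entry m i (suc j) + m * entry m i j) + entry m (suc i) j
      ≈⟨ +-cong (+-cong (entry-polynomial m i (suc j) (suc N) (ℕ.m<n⇒m<1+n i<N))
                        (*-congˡ (entry-polynomial m i j N i<N)))
                (entry-polynomial m (suc i) j (suc N) (s≤s i<N)) ⟩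
    (sumTo (suc N) (polynomialTerm m i (suc j)) + m * sumTo N (polynomialTerm m i j))
      + sumTo (suc N) (polynomialTerm m (suc i) j)
      ≈⟨ sumTo-pascal N m _ _ _ _ constant-term step ⟨
    sumTo (suc N) (polynomialTerm m (suc i) (suc j)) ∎
    where
    constant-term : polynomialTerm m (suc i) (suc j) 0 ≈ polynomialTerm m i (suc j) 0 + polynomialTerm m (suc i) j 0
    constant-term = trans (*-congʳ (ι-homo-+ (entryCoeff i (suc j) 0) _)) (distribʳ 1# _ _)
    step : ∀ k → polynomialTerm m (suc i) (suc j) (suc k)
                   ≈ (polynomialTerm m i (suc j) (suc k) + m * polynomialTerm m i j k) + polynomialTerm m (suc i) j (suc k)
    step k = trans (*-congʳ (trans (ι-homo-+ (c₀₁ ℕ.+ c₀₀) c₁₀) (+-congʳ (ι-homo-+ c₀₁ c₀₀))))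
      (solve 5 (λ a b c m M → (a :+ b :+ c) :* (m :* M) := (a :* (m :* M) :+ m :* (b :* M)) :+ c :* (m :* M))
        refl (ι c₀₁) (ι c₀₀) (ι c₁₀) m (pow m k))
      where
      c₀₁ c₀₀ c₁₀ : ℕ
      c₀₁ = entryCoeff i (suc j) (suc k)
      c₀₀ = entryCoeff i j k
      c₁₀ = entryCoeff (suc i) j (suc k)

  ι-*-≈0 : ∀ a {b} → ι b ≈ 0# → ι (a ℕ.* b) ≈ 0#
  ι-*-≈0 a {b} ιb≈0 = trans (ι-homo-* a b) (trans (*-congˡ ιb≈0) (zeroʳ (ι a)))

  ι-*-≉0 : ∀ a b → ι a ≉ 0# → ι b ≉ 0# → ι (a ℕ.* b) ≉ 0#
  ι-*-≉0 a b ιa≉0 ιb≉0 ιab≈0 = *-≉0 ιa≉0 ιb≉0 (trans (sym (ι-homo-* a b)) ιab≈0)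

  -- Translation by 1 permutes K, so Σ_x x = Σ_x (x + 1) = Σ_x x + |K| · 1.
  ι-size≈0 : ι size ≈ 0#
  ι-size≈0 = ∙-cancelˡ Σx (ι size) 0# (begin
    Σx + ι size                 ≈⟨ +-congˡ (ι-as-sum size) ⟩
    Σx + sum {size} (λ _ → 1#)  ≈⟨ ∑-distrib-+ to (λ _ → 1#) ⟨
    sum (λ k → to k + 1#)       ≈⟨ sum-cong-≋ (λ k → to∘from (to k + 1#)) ⟨
    sum (λ k → to (shift k))    ≈⟨ sum-permute to (permutation shift unshift shift∘unshift unshift∘shift) ⟨
    Σx                          ≈⟨ +-identityʳ Σx ⟨
    Σx + 0#                     ∎)
    where
    open import Data.Fin using (Fin)
    open import Data.Fin.Permutation using (permutation)
    open import Algebra.Properties.CommutativeMonoid.Sum +-commutativeMonoid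
      using (sum; sum-permute; sum-cong-≋; ∑-distrib-+)
    open Inverse enumeration using (to; from; from-cong; inverseˡ; inverseʳ)

    to∘from : ∀ x → to (from x) ≈ x
    to∘from x = inverseˡ ≡.refl

    from∘to : ∀ k → from (to k) ≡ k
    from∘to k = inverseʳ refl

    Σx : Carrier
    Σx = sum to

    ι-as-sum : ∀ n → ι n ≈ sum {n} (λ _ → 1#)
    ι-as-sum zero    = refl
    ι-as-sum (suc n) = +-congˡ (ι-as-sum n)

    shift unshift : Fin size → Fin size
    shift k   = from (to k + 1#)
    unshift k = from (to k + - 1#)

    shift∘unshift : ∀ k → shift (unshift k) ≡ k
    shift∘unshift k = ≡.trans (from-cong (begin
      to (unshift k) + 1#     ≈⟨ +-congʳ (to∘from (to k + - 1#)) ⟩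
      (to k + - 1#) + 1#      ≈⟨ +-assoc (to k) (- 1#) 1# ⟩
      to k + (- 1# + 1#)      ≈⟨ +-congˡ (-‿inverseˡ 1#) ⟩
      to k + 0#               ≈⟨ +-identityʳ (to k) ⟩
      to k                    ∎)) (from∘to k)

    unshift∘shift : ∀ k → unshift (shift k) ≡ k
    unshift∘shift k = ≡.trans (from-cong (begin
      to (shift k) + - 1#     ≈⟨ +-congʳ (to∘from (to k + 1#)) ⟩
      (to k + 1#) + - 1#      ≈⟨ +-assoc (to k) 1# (- 1#) ⟩
      to k + (1# + - 1#)      ≈⟨ +-congˡ (-‿inverseʳ 1#) ⟩
      to k + 0#               ≈⟨ +-identityʳ (to k) ⟩
      to k                    ∎)) (from∘to k)

  HasZeroEntry : Carrier → ℕ → Set ℓ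
  HasZeroEntry m N = ∃ λ i → ∃ λ j → i < N × j < N × entry m i j ≈ 0#

  hasZeroEntry-mono : ∀ {m N N′} → N ≤ N′ → HasZeroEntry m N → HasZeroEntry m N′
  hasZeroEntry-mono N≤N′ (i , j , i<N , j<N , aᵢⱼ≈0) =
    i , j , ℕ.<-≤-trans i<N N≤N′ , ℕ.<-≤-trans j<N N≤N′ , aᵢⱼ≈0

  module Characteristic (n : ℕ) (p-prime : Prime (suc n)) (ι[p]≈0 : ι (suc n) ≈ 0#) where

    open import Data.Nat using (_!; _%_)
    open import Data.Nat.DivMod using (m≡m%n+[m/n]*n; m%n<n)
    open import Function.Bundles using (mk⇔)
    open TensorSymmetry n using (m<pN⇒m/p<N)
    open import Data.Nat.Coprimality using (prime⇒coprime; coprime-Bézout)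
    open import Data.Nat.GCD using (module Bézout)
    open import Data.Nat.Combinatorics using (nCn≡1)
    open Arithmetic using (nCk*[k!*[n∸k]!]≡n!; n≤1+2[n/2])
    open import Data.Bool using (not)

    p : ℕ
    p = suc n

    ι-≉0 : ∀ {r} → 0 < r → r < p → ι r ≉ 0#
    ι-≉0 {r@(suc _)} _ r<p ιr≈0 with coprime-Bézout (prime⇒coprime p-prime r<p)
    ... | Bézout.+- x y 1+yr≡xp = 1≉0 (begin
      1#                 ≈⟨ +-identityʳ 1# ⟨
      1# + 0#            ≈⟨ +-congˡ (ι-*-≈0 y ιr≈0) ⟨
      ι (1 ℕ.+ y ℕ.* r)  ≡⟨ ≡.cong ι 1+yr≡xp ⟩
      ι (x ℕ.* p)        ≈⟨ ι-*-≈0 x ι[p]≈0 ⟩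
      0#                 ∎)
    ... | Bézout.-+ x y 1+xp≡yr = 1≉0 (begin
      1#                 ≈⟨ +-identityʳ 1# ⟨
      1# + 0#            ≈⟨ +-congˡ (ι-*-≈0 x ι[p]≈0) ⟨
      ι (1 ℕ.+ x ℕ.* p)  ≡⟨ ≡.cong ι 1+xp≡yr ⟩
      ι (y ℕ.* r)        ≈⟨ ι-*-≈0 y ιr≈0 ⟩
      0#                 ∎)

    ι-mod : ∀ a → ι (a % p) ≈ ι a
    ι-mod a = sym (begin
      ι a                              ≡⟨ ≡.cong ι (m≡m%n+[m/n]*n a p) ⟩
      ι (a % p ℕ.+ (a ℕ./ p) ℕ.* p)    ≈⟨ ι-homo-+ (a % p) _ ⟩
      ι (a % p) + ι ((a ℕ./ p) ℕ.* p)  ≈⟨ +-congˡ (ι-*-≈0 (a ℕ./ p) ι[p]≈0) ⟩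
      ι (a % p) + 0#                   ≈⟨ +-identityʳ _ ⟩
      ι (a % p)                        ∎)

    ι-!≉0 : ∀ {r} → r < p → ι (r !) ≉ 0#
    ι-!≉0 {zero}  _   ι1≈0 = 1≉0 (trans (sym ι-1) ι1≈0)
    ι-!≉0 {suc r} r<p = ι-*-≉0 (suc r) (r !) (ι-≉0 (s≤s z≤n) r<p) (ι-!≉0 (ℕ.<⇒≤ r<p))

    ι-C-!-decomposition : ∀ {y k} → k ≤ y → ι (y C k) * ι (k ! ℕ.* (y ∸ k) !) ≈ ι (y !)
    ι-C-!-decomposition {y} {k} k≤y =
      trans (sym (ι-homo-* (y C k) _)) (reflexive (≡.cong ι (nCk*[k!*[n∸k]!]≡n! k≤y)))

    ι-C-≉0 : ∀ {y k} → k ≤ y → y < p → ι (y C k) ≉ 0#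
    ι-C-≉0 {y} {k} k≤y y<p ιC≈0 =
      ι-!≉0 y<p (trans (sym (ι-C-!-decomposition k≤y)) (x≈0⇒x*y≈0 _ ιC≈0))

    -- p! vanishes while k!(p - k)! does not.
    ι-pCk≈0 : ∀ {k} → 0 < k → k < p → ι (p C k) ≈ 0#
    ι-pCk≈0 {k} 0<k k<p = x*y≈0⇒x≈0
      (ι-*-≉0 (k !) ((p ∸ k) !) (ι-!≉0 k<p) (ι-!≉0 (ℕ.∸-monoʳ-< {p} {k} {0} 0<k (ℕ.<⇒≤ k<p))))
      (trans (ι-C-!-decomposition (ℕ.<⇒≤ k<p)) (trans (ι-homo-* p (n !)) (x≈0⇒x*y≈0 _ ι[p]≈0)))

    ι-[p-1]Ck≈[-1]^k : ∀ k → k ≤ n → ι (n C k) ≈ pow (- 1#) k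
    ι-[p-1]Ck≈[-1]^k zero    _   = ι-1
    ι-[p-1]Ck≈[-1]^k (suc k) k<n = begin
      ι (n C suc k)        ≈⟨ inverseʳ-unique (ι (n C k)) _ pascal≈0 ⟩
      - ι (n C k)          ≈⟨ -‿cong (ι-[p-1]Ck≈[-1]^k k (ℕ.<⇒≤ k<n)) ⟩
      - pow (- 1#) k       ≈⟨ -1*x≈-x _ ⟨
      pow (- 1#) (suc k)   ∎
      where
      pascal≈0 : ι (n C k) + ι (n C suc k) ≈ 0#
      pascal≈0 = trans (sym (ι-pascal n k)) (ι-pCk≈0 (s≤s z≤n) (s≤s k<n))

    [-1]^[p-1]≈1 : pow (- 1#) n ≈ 1#
    [-1]^[p-1]≈1 = begin
      pow (- 1#) n   ≈⟨ ι-[p-1]Ck≈[-1]^k n ℕ.≤-refl ⟨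
      ι (n C n)      ≡⟨ ≡.cong ι (nCn≡1 n) ⟩
      ι 1            ≈⟨ ι-1 ⟩
      1#             ∎

    frobenius-1+ : ∀ x → pow (1# + x) p ≈ 1# + pow x p
    frobenius-1+ x = begin
      pow (1# + x) p
        ≈⟨ binomial x p (suc p) ℕ.≤-refl ⟩
      sumTo p t + t p
        ≈⟨ +-congʳ (sumTo-head n t) ⟩
      (t 0 + sumTo n (λ k → t (suc k))) + t p
        ≈⟨ +-cong (+-cong (trans (*-identityʳ (ι 1)) ι-1)
                          (sumTo-zero n _ (λ k k<n → x≈0⇒x*y≈0 _ (ι-pCk≈0 (s≤s z≤n) (s≤s k<n)))))
                  (trans (*-congʳ (trans (reflexive (≡.cong ι (nCn≡1 p))) ι-1)) (*-identityˡ _)) ⟩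
      (1# + 0#) + pow x p
        ≈⟨ +-congʳ (+-identityʳ 1#) ⟩
      1# + pow x p ∎
      where
      t : ℕ → Carrier
      t k = ι (p C k) * pow x k

    frobenius-+ : ∀ x y → pow (x + y) p ≈ pow x p + pow y p
    frobenius-+ x y with y ≟ 0#
    ... | yes y≈0 = begin
      pow (x + y) p          ≈⟨ pow-cong p (trans (+-congˡ y≈0) (+-identityʳ x)) ⟩
      pow x p                ≈⟨ +-identityʳ (pow x p) ⟨
      pow x p + 0#           ≈⟨ +-congˡ (x≈0⇒x*y≈0 (pow y n) y≈0) ⟨
      pow x p + pow y p      ∎
    ... | no y≉0 = begin
      pow (x + y) p                       ≈⟨ pow-cong p x+y≈y[1+xy⁻¹] ⟩
      pow (y * (1# + x * y ⁻¹)) p         ≈⟨ pow-distribʳ-* y _ p ⟩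
      pow y p * pow (1# + x * y ⁻¹) p     ≈⟨ *-congˡ (trans (frobenius-1+ (x * y ⁻¹)) (+-congˡ (pow-distribʳ-* x (y ⁻¹) p))) ⟩
      pow y p * (1# + pow x p * pow (y ⁻¹) p)
        ≈⟨ solve 3 (λ a b c → a :* (con 1 :+ b :* c) := b :* (a :* c) :+ a) refl (pow y p) (pow x p) (pow (y ⁻¹) p) ⟩
      pow x p * (pow y p * pow (y ⁻¹) p) + pow y p
        ≈⟨ +-congʳ (trans (*-congˡ (pow-inverse p y≉0)) (*-identityʳ _)) ⟩
      pow x p + pow y p                   ∎
      where
      x+y≈y[1+xy⁻¹] : x + y ≈ y * (1# + x * y ⁻¹)
      x+y≈y[1+xy⁻¹] = begin
        x + y                    ≈⟨ +-cong (trans (*-congˡ (⁻¹-inverseˡ y≉0)) (*-identityʳ x)) (*-identityʳ y) ⟨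
        x * (y ⁻¹ * y) + y * 1#  ≈⟨ solve 3 (λ x y z → x :* (z :* y) :+ y :* con 1 := y :* (con 1 :+ x :* z)) refl x y (y ⁻¹) ⟩
        y * (1# + x * y ⁻¹)      ∎

    entry-frobenius : ∀ m i j → entry (pow m p) i j ≈ pow (entry m i j) p
    entry-frobenius m zero    j       = sym (pow-1# p)
    entry-frobenius m (suc i) zero    = sym (pow-1# p)
    entry-frobenius m (suc i) (suc j) = begin
      (entry (pow m p) i (suc j) + pow m p * entry (pow m p) i j) + entry (pow m p) (suc i) j
        ≈⟨ +-cong (+-cong (entry-frobenius m i (suc j)) (*-congˡ (entry-frobenius m i j)))
                  (entry-frobenius m (suc i) j) ⟩
      (pow a₀₁ p + pow m p * pow a₀₀ p) + pow a₁₀ p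
        ≈⟨ +-congʳ (+-congˡ (pow-distribʳ-* m a₀₀ p)) ⟨
      (pow a₀₁ p + pow (m * a₀₀) p) + pow a₁₀ p
        ≈⟨ trans (frobenius-+ _ a₁₀) (+-congʳ (frobenius-+ a₀₁ _)) ⟨
      pow ((a₀₁ + m * a₀₀) + a₁₀) p ∎
      where
      a₀₁ a₀₀ a₁₀ : Carrier
      a₀₁ = entry m i (suc j)
      a₀₀ = entry m i j
      a₁₀ = entry m (suc i) j

    -- Delannoy's formula with C(p - 1, k) = (-1)^k collapses to (1 - (1 + m))^i.
    entry-lastColumn : ∀ m i → i ≤ n → entry m i n ≈ pow (- m) i
    entry-lastColumn m i i≤n = begin
      entry m i n                                    ≈⟨ entry-delannoy m i n (suc i) ℕ.≤-refl ⟩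
      sumTo (suc i) (delannoyTerm u i n)             ≈⟨ sumTo-cong (suc i) term ⟩
      sumTo (suc i) (λ k → ι (i C k) * pow (- u) k)  ≈⟨ binomial (- u) i (suc i) ℕ.≤-refl ⟨
      pow (1# + - u) i                               ≈⟨ pow-cong i 1-u≈-m ⟩
      pow (- m) i                                    ∎
      where
      u : Carrier
      u = 1# + m
      term : ∀ k → k < suc i → delannoyTerm u i n k ≈ ι (i C k) * pow (- u) k
      term k (s≤s k≤i) = begin
        ι (i C k) * ι (n C k) * pow u k          ≈⟨ *-assoc _ _ _ ⟩
        ι (i C k) * (ι (n C k) * pow u k)        ≈⟨ *-congˡ (*-congʳ (ι-[p-1]Ck≈[-1]^k k (ℕ.≤-trans k≤i i≤n))) ⟩
        ι (i C k) * (pow (- 1#) k * pow u k)     ≈⟨ *-congˡ (pow-distribʳ-* (- 1#) u k) ⟨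
        ι (i C k) * pow (- 1# * u) k             ≈⟨ *-congˡ (pow-cong k (-1*x≈-x u)) ⟩
        ι (i C k) * pow (- u) k                  ∎
      1-u≈-m : 1# + - u ≈ - m
      1-u≈-m = inverseʳ-unique m _ (begin
        m + (1# + - u)  ≈⟨ solve 3 (λ m o w → m :+ (o :+ w) := (o :+ m) :+ w) refl m 1# (- u) ⟩
        u + - u         ≈⟨ -‿inverseʳ u ⟩
        0#              ∎)

    lastColumn-cancel : ∀ m r → suc r ≤ n → m * entry m r n + entry m (suc r) n ≈ 0#
    lastColumn-cancel m r r<n = begin
      m * entry m r n + entry m (suc r) n     ≈⟨ +-cong (*-congˡ (entry-lastColumn m r (ℕ.<⇒≤ r<n)))
                                                        (entry-lastColumn m (suc r) r<n) ⟩
      m * pow (- m) r + - m * pow (- m) r     ≈⟨ distribʳ (pow (- m) r) m (- m) ⟨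
      (m + - m) * pow (- m) r                 ≈⟨ x≈0⇒x*y≈0 _ (-‿inverseʳ m) ⟩
      0#                                      ∎

    lastRow-cancel : ∀ m s → suc s ≤ n → entry m n (suc s) + m * entry m n s ≈ 0#
    lastRow-cancel m s s<n =
      trans (trans (+-comm _ _) (+-cong (*-congˡ (entry-comm m n s)) (entry-comm m n (suc s))))
            (lastColumn-cancel m s s<n)

    m*[-m]^[p-1]≈m^p : ∀ m → m * pow (- m) n ≈ pow m p
    m*[-m]^[p-1]≈m^p m = *-congˡ (begin
      pow (- m) n                ≈⟨ pow-cong n (-1*x≈-x m) ⟨
      pow (- 1# * m) n           ≈⟨ pow-distribʳ-* (- 1#) m n ⟩
      pow (- 1#) n * pow m n     ≈⟨ *-congʳ [-1]^[p-1]≈1 ⟩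
      1# * pow m n               ≈⟨ *-identityˡ (pow m n) ⟩
      pow m n                    ∎)

    entry-lucas : ∀ m i r j s → r < p → s < p →
      entry m (r ℕ.+ i ℕ.* p) (s ℕ.+ j ℕ.* p) ≈ entry (pow m p) i j * entry m r s
    entry-lucas m zero    zero    j       s       _   _   = sym (*-identityˡ 1#)
    entry-lucas m i       (suc r) zero    zero    _   _   = sym (trans (*-congʳ (entry-zeroʳ _ i)) (*-identityˡ 1#))
    entry-lucas m (suc i) zero    zero    zero    _   _   = sym (*-identityˡ 1#)
    entry-lucas m i       (suc r) j       (suc s) r<p s<p = begin
      (entry m I (suc J) + m * entry m I J) + entry m (suc I) J
        ≈⟨ +-cong (+-cong (entry-lucas m i r j (suc s) (ℕ.<⇒≤ r<p) s<p)
                          (*-congˡ (entry-lucas m i r j s (ℕ.<⇒≤ r<p) (ℕ.<⇒≤ s<p))))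
                  (entry-lucas m i (suc r) j s r<p (ℕ.<⇒≤ s<p)) ⟩
      (c * entry m r (suc s) + m * (c * entry m r s)) + c * entry m (suc r) s
        ≈⟨ solve 5 (λ c a b d m → (c :* a :+ m :* (c :* b)) :+ c :* d := c :* ((a :+ m :* b) :+ d)) refl
             c (entry m r (suc s)) (entry m r s) (entry m (suc r) s) m ⟩
      c * entry m (suc r) (suc s) ∎
      where
      I J : ℕ
      I = r ℕ.+ i ℕ.* p
      J = s ℕ.+ j ℕ.* p
      c : Carrier
      c = entry (pow m p) i j
    entry-lucas m i       (suc r) (suc j) zero    r<p _   = begin
      (entry m I (suc J) + m * entry m I J) + entry m (suc I) J
        ≈⟨ +-cong (+-cong (entry-lucas m i r (suc j) 0 (ℕ.<⇒≤ r<p) (s≤s z≤n))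
                          (*-congˡ (entry-lucas m i r j n (ℕ.<⇒≤ r<p) ℕ.≤-refl)))
                  (entry-lucas m i (suc r) j n r<p ℕ.≤-refl) ⟩
      (c₁ * entry m r 0 + m * (c₀ * entry m r n)) + c₀ * entry m (suc r) n
        ≈⟨ solve 6 (λ c₁ c₀ e a b m → (c₁ :* e :+ m :* (c₀ :* a)) :+ c₀ :* b := c₁ :* e :+ c₀ :* (m :* a :+ b)) refl
             c₁ c₀ (entry m r 0) (entry m r n) (entry m (suc r) n) m ⟩
      c₁ * entry m r 0 + c₀ * (m * entry m r n + entry m (suc r) n)
        ≈⟨ +-cong (*-congˡ (entry-zeroʳ m r)) (trans (*-congˡ (lastColumn-cancel m r (ℕ.≤-pred r<p))) (zeroʳ c₀)) ⟩
      c₁ * 1# + 0#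
        ≈⟨ +-identityʳ _ ⟩
      c₁ * 1# ∎
      where
      I J : ℕ
      I = r ℕ.+ i ℕ.* p
      J = n ℕ.+ j ℕ.* p
      c₁ c₀ : Carrier
      c₁ = entry (pow m p) i (suc j)
      c₀ = entry (pow m p) i j
    entry-lucas m (suc i) zero    j       (suc s) _   s<p = begin
      (entry m I (suc J) + m * entry m I J) + entry m (suc I) J
        ≈⟨ +-cong (+-cong (entry-lucas m i n j (suc s) ℕ.≤-refl s<p)
                          (*-congˡ (entry-lucas m i n j s ℕ.≤-refl (ℕ.<⇒≤ s<p))))
                  (entry-lucas m (suc i) 0 j s (s≤s z≤n) (ℕ.<⇒≤ s<p)) ⟩
      (c₀ * entry m n (suc s) + m * (c₀ * entry m n s)) + c₁ * 1#
        ≈⟨ solve 5 (λ c₀ c₁ a b m → (c₀ :* a :+ m :* (c₀ :* b)) :+ c₁ :* con 1 := c₁ :* con 1 :+ c₀ :* (a :+ m :* b)) refl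
             c₀ c₁ (entry m n (suc s)) (entry m n s) m ⟩
      c₁ * 1# + c₀ * (entry m n (suc s) + m * entry m n s)
        ≈⟨ +-congˡ (trans (*-congˡ (lastRow-cancel m s (ℕ.≤-pred s<p))) (zeroʳ c₀)) ⟩
      c₁ * 1# + 0#
        ≈⟨ +-identityʳ _ ⟩
      c₁ * 1# ∎
      where
      I J : ℕ
      I = n ℕ.+ i ℕ.* p
      J = s ℕ.+ j ℕ.* p
      c₁ c₀ : Carrier
      c₁ = entry (pow m p) (suc i) j
      c₀ = entry (pow m p) i j
    entry-lucas m (suc i) zero    (suc j) zero    _   _   = begin
      (entry m I (suc J) + m * entry m I J) + entry m (suc I) J
        ≈⟨ +-cong (+-cong (entry-lucas m i n (suc j) 0 ℕ.≤-refl (s≤s z≤n))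
                          (*-congˡ (entry-lucas m i n j n ℕ.≤-refl ℕ.≤-refl)))
                  (entry-lucas m (suc i) 0 j n (s≤s z≤n) ℕ.≤-refl) ⟩
      (c₀₁ * entry m n 0 + m * (c₀₀ * entry m n n)) + c₁₀ * 1#
        ≈⟨ +-congʳ (+-cong (*-congˡ (entry-zeroʳ m n)) (*-congˡ (*-congˡ (entry-lastColumn m n ℕ.≤-refl)))) ⟩
      (c₀₁ * 1# + m * (c₀₀ * pow (- m) n)) + c₁₀ * 1#
        ≈⟨ solve 5 (λ a b d m P → (a :* con 1 :+ m :* (b :* P)) :+ d :* con 1 := ((a :+ (m :* P) :* b) :+ d) :* con 1)
             refl c₀₁ c₀₀ c₁₀ m (pow (- m) n) ⟩
      ((c₀₁ + (m * pow (- m) n) * c₀₀) + c₁₀) * 1#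
        ≈⟨ *-congʳ (+-congʳ (+-congˡ (*-congʳ (m*[-m]^[p-1]≈m^p m)))) ⟩
      ((c₀₁ + pow m p * c₀₀) + c₁₀) * 1# ∎
      where
      I J : ℕ
      I = n ℕ.+ i ℕ.* p
      J = n ℕ.+ j ℕ.* p
      c₀₁ c₀₀ c₁₀ : Carrier
      c₀₁ = entry (pow m p) i (suc j)
      c₀₀ = entry (pow m p) i j
      c₁₀ = entry (pow m p) (suc i) j

    hasZeroEntry-frobenius : ∀ {m N} → HasZeroEntry (pow m p) N → HasZeroEntry m N
    hasZeroEntry-frobenius {m} (i , j , i<N , j<N , aᵢⱼ≈0) =
      i , j , i<N , j<N , pow≈0⇒≈0 p (trans (sym (entry-frobenius m i j)) aᵢⱼ≈0)

    entry-lucas-divMod : ∀ m I J → entry m I J ≈ entry (pow m p) (I / p) (J / p) * entry m (I % p) (J % p)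
    entry-lucas-divMod m I J =
      trans (reflexive (≡.cong₂ (entry m) (m≡m%n+[m/n]*n I p) (m≡m%n+[m/n]*n J p)))
            (entry-lucas m (I / p) (I % p) (J / p) (J % p) (m%n<n I p) (m%n<n J p))

    hasZeroEntry-descend : ∀ d m → HasZeroEntry m (p ^ suc d) → HasZeroEntry m p
    hasZeroEntry-descend zero m = hasZeroEntry-mono (ℕ.≤-reflexive (ℕ.*-identityʳ p))
    hasZeroEntry-descend (suc d) m (I , J , I<pᵈ⁺² , J<pᵈ⁺² , a≈0)
      with x*y≈0⇒x≈0⊎y≈0 (trans (sym (entry-lucas-divMod m I J)) a≈0)
    ... | inj₁ upper≈0 = hasZeroEntry-frobenius (hasZeroEntry-descend d (pow m p)
            (I / p , J / p , m<pN⇒m/p<N (p ^ suc d) I<pᵈ⁺² , m<pN⇒m/p<N (p ^ suc d) J<pᵈ⁺² , upper≈0))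
    ... | inj₂ lower≈0 = I % p , J % p , m%n<n I p , m%n<n J p , lower≈0

    hasZeroEntry-p^d⇔p : ∀ m d → 1 ≤ d → HasZeroEntry m (p ^ d) ⇔ HasZeroEntry m p
    hasZeroEntry-p^d⇔p m (suc d) _ =
      mk⇔ (hasZeroEntry-descend d m) (hasZeroEntry-mono (ℕ.m≤m*n p (p ^ d) {{ℕ.m^n≢0 p d}}))

    ordered-zero⇒extDegree≤ : ∀ {m x y} h → x ≤ h → x ≤ y → y < p → entry m x y ≈ 0# → ExtDegree≤ p m h
    ordered-zero⇒extDegree≤ {m} {x} {y} h x≤h x≤y y<p aₓᵧ≈0 =
      (λ k → entryCoeff x y k % p) , (λ k → m%n<n (entryCoeff x y k) p) , (x , x≤h , leading≉0) , root
      where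
      leading≉0 : ι (entryCoeff x y x % p) ≉ 0#
      leading≉0 ι≈0 = ι-C-≉0 x≤y y<p
        (trans (reflexive (≡.cong ι (≡.sym (entryCoeff-leading x y)))) (trans (sym (ι-mod (entryCoeff x y x))) ι≈0))
      root : sumTo (suc h) (λ k → ι (entryCoeff x y k % p) * pow m k) ≈ 0#
      root = begin
        sumTo (suc h) (λ k → ι (entryCoeff x y k % p) * pow m k)
          ≈⟨ sumTo-cong (suc h) (λ k _ → *-congʳ (ι-mod (entryCoeff x y k))) ⟩
        sumTo (suc h) (polynomialTerm m x y)
          ≈⟨ entry-polynomial m x y (suc h) (s≤s x≤h) ⟨
        entry m x y
          ≈⟨ aₓᵧ≈0 ⟩
        0# ∎

    module Reflection {m : Carrier} (m≉0 : m ≉ 0#) where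

      w : Carrier
      w = (- m) ⁻¹

      w≉0 : w ≉ 0#
      w≉0 = ⁻¹-≉0 (-‿≉0 m≉0)

      entry-⁻¹-reflect : ∀ i j k → j ℕ.+ k ≡ n → i ≤ n → entry (m ⁻¹) i k * pow (- m) i ≈ entry m i j
      entry-⁻¹-reflect zero    j       k _ _ = *-identityˡ 1#
      entry-⁻¹-reflect (suc i) zero    k ≡.refl 1+i≤n = begin
        entry (m ⁻¹) (suc i) n * pow (- m) (suc i)     ≈⟨ *-congʳ (entry-lastColumn (m ⁻¹) (suc i) 1+i≤n) ⟩
        pow (- m ⁻¹) (suc i) * pow (- m) (suc i)       ≈⟨ pow-distribʳ-* (- m ⁻¹) (- m) (suc i) ⟨
        pow (- m ⁻¹ * - m) (suc i)                     ≈⟨ pow-cong (suc i) (trans (-x*-y≈x*y (m ⁻¹) m) (⁻¹-inverseˡ m≉0)) ⟩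
        pow 1# (suc i)                                 ≈⟨ pow-1# (suc i) ⟩
        1#                                             ∎
      entry-⁻¹-reflect (suc i) (suc j) k 1+j+k≡n 1+i≤n = begin
        Z * (q * Q)
          ≈⟨ cancellation ⟨
        ((X + m ⁻¹ * Y) + Z) * (q * Q) + m * (X * Q) + Y * Q
          ≈⟨ +-cong (+-cong (entry-⁻¹-reflect (suc i) j (suc k) j+1+k≡n 1+i≤n)
                            (*-congˡ (entry-⁻¹-reflect i j (suc k) j+1+k≡n i≤n)))
                    (entry-⁻¹-reflect i (suc j) k 1+j+k≡n i≤n) ⟩
        (entry m (suc i) j + m * entry m i j) + entry m i (suc j)
          ≈⟨ solve 3 (λ a b d → (a :+ b) :+ d := (d :+ b) :+ a) refl _ _ _ ⟩
        (entry m i (suc j) + m * entry m i j) + entry m (suc i) j ∎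
        where
        i≤n : i ≤ n
        i≤n = ℕ.<⇒≤ 1+i≤n
        j+1+k≡n : j ℕ.+ suc k ≡ n
        j+1+k≡n = ≡.trans (ℕ.+-suc j k) 1+j+k≡n
        q Q X Y Z : Carrier
        q = - m
        Q = pow q i
        X = entry (m ⁻¹) i (suc k)
        Y = entry (m ⁻¹) i k
        Z = entry (m ⁻¹) (suc i) k
        -- q + m = 0 and m⁻¹ q + 1 = 0 kill the X and Y terms.
        cancellation : ((X + m ⁻¹ * Y) + Z) * (q * Q) + m * (X * Q) + Y * Q ≈ Z * (q * Q)
        cancellation = begin
          ((X + m ⁻¹ * Y) + Z) * (q * Q) + m * (X * Q) + Y * Q
            ≈⟨ solve 7 (λ X Y Z Q q m m′ → ((X :+ m′ :* Y) :+ Z) :* (q :* Q) :+ m :* (X :* Q) :+ Y :* Q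
                          := Z :* (q :* Q) :+ (X :* Q :* (q :+ m) :+ Y :* Q :* (m′ :* q :+ con 1)))
                 refl X Y Z Q q m (m ⁻¹) ⟩
          Z * (q * Q) + (X * Q * (q + m) + Y * Q * (m ⁻¹ * q + 1#))
            ≈⟨ +-congˡ (+-cong (trans (*-congˡ (-‿inverseˡ m)) (zeroʳ _))
                               (trans (*-congˡ m⁻¹q+1≈0) (zeroʳ _))) ⟩
          Z * (q * Q) + (0# + 0#)
            ≈⟨ trans (+-congˡ (+-identityʳ 0#)) (+-identityʳ _) ⟩
          Z * (q * Q) ∎
          where
          m⁻¹q+1≈0 : m ⁻¹ * q + 1# ≈ 0#
          m⁻¹q+1≈0 = trans (+-congʳ (trans (sym (-‿distribʳ-* (m ⁻¹) m)) (-‿cong (⁻¹-inverseˡ m≉0))))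
                           (-‿inverseˡ 1#)

      entry-⁻¹-reverse : ∀ i j → i < p → j < p → entry (m ⁻¹) i (n ∸ j) ≈ entry m i j * pow w i
      entry-⁻¹-reverse i j (s≤s i≤n) (s≤s j≤n) = begin
        E                          ≈⟨ *-identityʳ E ⟨
        E * 1#                     ≈⟨ *-congˡ (pow-inverse i (-‿≉0 m≉0)) ⟨
        E * (pow (- m) i * pow w i) ≈⟨ *-assoc E _ _ ⟨
        (E * pow (- m) i) * pow w i ≈⟨ *-congʳ (entry-⁻¹-reflect i j (n ∸ j) (ℕ.m+[n∸m]≡n j≤n) i≤n) ⟩
        entry m i j * pow w i      ∎
        where
        E : Carrier
        E = entry (m ⁻¹) i (n ∸ j)

      entry-antidiagonal : ∀ i j → i < p → j < p →
        entry m i j * pow w i ≈ entry m (n ∸ j) (n ∸ i) * pow w (n ∸ j)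
      entry-antidiagonal i j i<p@(s≤s i≤n) j<p = begin
        entry m i j * pow w i                 ≈⟨ entry-⁻¹-reverse i j i<p j<p ⟨
        entry (m ⁻¹) i (n ∸ j)                ≈⟨ entry-comm (m ⁻¹) i (n ∸ j) ⟩
        entry (m ⁻¹) (n ∸ j) i                ≡⟨ ≡.cong (entry (m ⁻¹) (n ∸ j)) (ℕ.m∸[m∸n]≡n i≤n) ⟨
        entry (m ⁻¹) (n ∸ j) (n ∸ (n ∸ i))    ≈⟨ entry-⁻¹-reverse (n ∸ j) (n ∸ i) (s≤s (ℕ.m∸n≤m n j)) (s≤s (ℕ.m∸n≤m n i)) ⟩
        entry m (n ∸ j) (n ∸ i) * pow w (n ∸ j) ∎

      δ-entry-⁻¹-reverse : ∀ i j → i < p → j < p → δ (entry m) i j ≡ δ (entry (m ⁻¹)) i (n ∸ j)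
      δ-entry-⁻¹-reverse i j i<p j<p = ≡.cong not
        (does-≈0-balance (pow-≉0 i w≉0) 1≉0 (sym (trans (*-identityʳ _) (entry-⁻¹-reverse i j i<p j<p))))

      δ-entry-bothDiagSymmetric : BothDiagSymmetric p (δ (entry m))
      δ-entry-bothDiagSymmetric i j i<p j<p =
        ≡.cong not (does-≈0-≡ (trans (entry-comm m j i)) (trans (entry-comm m i j))) ,
        ≡.cong not (does-≈0-balance (pow-≉0 i w≉0) (pow-≉0 (n ∸ j) w≉0) (entry-antidiagonal i j i<p j<p))

      ordered-zero⇒extDegree≤half : ∀ {x y} → x ≤ y → y < p → entry m x y ≈ 0# → ExtDegree≤ p m (n / 2)
      ordered-zero⇒extDegree≤half {x} {y} x≤y y<p aₓᵧ≈0 with x ℕ.≤? n / 2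
      ... | yes x≤h = ordered-zero⇒extDegree≤ (n / 2) x≤h x≤y y<p aₓᵧ≈0
      ... | no x≰h  = ordered-zero⇒extDegree≤ (n / 2) n∸y≤h (ℕ.∸-monoʳ-≤ n x≤y) (s≤s (ℕ.m∸n≤m n x)) reflected≈0
        where
        y≤n : y ≤ n
        y≤n = ℕ.≤-pred y<p
        reflected≈0 : entry m (n ∸ y) (n ∸ x) ≈ 0#
        reflected≈0 = x*y≈0⇒x≈0 (pow-≉0 (n ∸ y) w≉0)
          (trans (sym (entry-antidiagonal x y (s≤s (ℕ.≤-trans x≤y y≤n)) y<p)) (x≈0⇒x*y≈0 _ aₓᵧ≈0))
        n∸y≤h : n ∸ y ≤ n / 2
        n∸y≤h = ℕ.≤-trans (ℕ.∸-monoʳ-≤ n (ℕ.≤-trans (ℕ.≰⇒> x≰h) x≤y)) (ℕ.m≤n+o⇒m∸n≤o n (suc (n / 2)) (n≤1+2[n/2] n))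

      extDegree≤half : HasZeroEntry m p → ExtDegree≤ p m (n / 2)
      extDegree≤half (i , j , i<p , j<p , aᵢⱼ≈0) with ℕ.≤-total i j
      ... | inj₁ i≤j = ordered-zero⇒extDegree≤half i≤j j<p aᵢⱼ≈0
      ... | inj₂ j≤i = ordered-zero⇒extDegree≤half j≤i i<p (trans (entry-comm m j i) aᵢⱼ≈0)

lemma4p5 : {c ℓ : Level} (p : ℕ) (pr : Prime p) (K : FiniteField c ℓ)
  (e : ℕ) → 1 ≤ e → FiniteField.size K ≡ p ^ e →
  let open FiniteField K
      open FieldDefs K
  in (m : Carrier) → ¬ (m ≈ 0#) →
  let a  = entry m
      a′ = entry (m ⁻¹)
      w  = (- m) ⁻¹
  in -- (1)
     (∀ i j → i < p → j < p → a′ i (p ∸ 1 ∸ j) ≈ a i j * pow w i)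
     -- (2)
   × (∀ i j → i < p → j < p →
        a i j * pow w i ≈ a (p ∸ 1 ∸ j) (p ∸ 1 ∸ i) * pow w (p ∸ 1 ∸ j))
     -- (3)
   × (∀ i j → i < p → j < p →
        (δ a i j ≡ δ (Σrev p a′) i j) × (δ (Σrev p a′) i j ≡ Σrev p (δ a′) i j))
     -- (4)
   × BothDiagSymmetric p (δ a)
   × (∀ d → 1 ≤ d →
        BothDiagSymmetric (p ^ d) (tpow p {{prime⇒nonZero pr}} (δ a) d))
     -- (5)
   × (∀ d → 1 ≤ d →
        ((∃ λ i → ∃ λ j → i < p ^ d × j < p ^ d × a i j ≈ 0#)
          ⇔ (∃ λ i → ∃ λ j → i < p × j < p × a i j ≈ 0#)))
   × ((∃ λ i → ∃ λ j → i < p × j < p × a i j ≈ 0#) →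
        ExtDegree≤ p m ((p ∸ 1) / 2))
lemma4p5 zero p-prime K e _ _ = ⊥-elim (NonZero.nonZero (prime⇒nonZero p-prime))
lemma4p5 (suc n) p-prime K e _ size≡pᵉ m m≉0 =
  entry-⁻¹-reverse ,
  entry-antidiagonal ,
  (λ i j i<p j<p → δ-entry-⁻¹-reverse i j i<p j<p , ≡.refl) ,
  δ-entry-bothDiagSymmetric ,
  TensorSymmetry.tpow-bothDiagSymmetric n (δ (entry m)) δ-entry-bothDiagSymmetric ,
  hasZeroEntry-p^d⇔p m ,
  extDegree≤half
  where
  open FiniteField K
  open FieldDefs K
  open FieldProperties K
  ι[p]≈0 : ι (suc n) ≈ 0#
  ι[p]≈0 = pow≈0⇒≈0 e (trans (sym (ι-homo-^ (suc n) e)) (≡.subst (λ t → ι t ≈ 0#) size≡pᵉ ι-size≈0))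
  open Characteristic n p-prime ι[p]≈0
  open Reflection m≉0
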